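{- Let $M_{c,2}$ be the set of positive integers $n$ such that $g(n) - \gamma_c(X_n) \geq 2$. Then the set $\omega(M_{c,2}) = \{\omega(n) : n \in M_{c,2}\}$ is unbounded. Equivalently, for every $N$ there is a positive integer $n$ with at least $N$ distinct prime factors such that $\gamma_c(X_n) \leq g(n) - 2$.
   Context: For a positive integer $n$, the unitary Cayley graph $X_n$ is the graph with vertex set $\{0,1,\dots,n-1\}$ in which $a$ and $b$ are adjacent iff $\gcd(a-b,n)=1$. The Jacobsthal function $g(n)$ is the least positive integer $m$ such that every set of $m$ consecutive integers contains an integer coprime to $n$. A set $S$ of vertices of a graph $G$ is dominating if every vertex of $G$ is in $S$ or adjacent to a vertex of $S$. The cycle domination number $\gamma_c(G)$ is the minimum number of vertices of a cycle in $G$ whose vertex set is dominating (such a cycle exists in $X_n$, e.g. $(0,1,\dots,n-1)$). $\omega(n)$ denotes the number of distinct prime factors of $n$. -}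

module Defs where

open import Data.Nat using (ℕ; zero; suc; _+_; _∸_; _≤_; _<_; ∣_-_∣)
open import Data.Nat.Coprimality using (Coprime)
open import Data.Nat.Divisibility using (_∣_)
open import Data.Nat.Primality using (Prime)
open import Data.Integer as ℤ using (ℤ; +_)
open import Data.Fin using (Fin; toℕ)
open import Data.List using (List; length)
open import Data.List.Relation.Unary.All using (All)
open import Data.List.Relation.Unary.Unique.Propositional using (Unique)
open import Data.Product using (Σ; ∃; ∃-syntax; _×_)
open import Data.Sum using (_⊎_)
open import Relation.Binary.PropositionalEquality using (_≡_)
open import Relation.Nullary using (¬_)
open import Function.Definitions using (Injective)

-- Unitary Cayley graph X_n on vertices {0,…,n-1} (Fin n):
-- a ~ b iff gcd(a - b, n) = 1, i.e. |a - b| coprime to n.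
Adj : (n : ℕ) → Fin n → Fin n → Set
Adj n a b = Coprime ∣ toℕ a - toℕ b ∣ n

HasCoprimeIn : ℕ → ℕ → Set
HasCoprimeIn n m = ∀ (a : ℤ) → ∃[ i ] (i < m × Coprime ℤ.∣ a ℤ.+ (+ i) ∣ n)

IsJacobsthal : ℕ → ℕ → Set
IsJacobsthal n m =
  1 ≤ m × HasCoprimeIn n m × (∀ m' → 1 ≤ m' → m' < m → ¬ HasCoprimeIn n m')

IsCycle : (n k : ℕ) → (Fin k → Fin n) → Set
IsCycle n k f =
  3 ≤ k × Injective _≡_ _≡_ f ×
  (∀ (i j : Fin k) →
     (toℕ j ≡ suc (toℕ i) ⊎ (toℕ i ≡ k ∸ 1 × toℕ j ≡ 0)) →
     Adj n (f i) (f j))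

Dominates : (n k : ℕ) → (Fin k → Fin n) → Set
Dominates n k f = ∀ (v : Fin n) → ∃[ i ] (v ≡ f i ⊎ Adj n v (f i))

HasDominatingCycle : ℕ → ℕ → Set
HasDominatingCycle n k = Σ (Fin k → Fin n) λ f → IsCycle n k f × Dominates n k f

AtLeastPrimeFactors : ℕ → ℕ → Set
AtLeastPrimeFactors N n =
  ∃[ ps ] (Unique ps × All Prime ps × All (_∣ n) ps × N ≤ length ps)

-- γ_c(X_n) ≤ g(n) - 2, i.e. g(n) - γ_c(X_n) ≥ 2.
GapAtLeast2 : ℕ → Set
GapAtLeast2 n = ∃[ m ] ∃[ k ] (IsJacobsthal n m × HasDominatingCycle n k × k + 2 ≤ m)

module Submission where

-- Put t = N + 1, M = 105·t, B = M + 105 and A = 105·B!·B!, and sieve the window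
-- A + 48 + i, i < M + 10.  Each hole i (48 + i coprime to 105; there are
-- 48·t + 2 of them) gets a prime q i > B dividing A + 48 + i, and
-- n = 105·∏ q i.  Every number of the window then shares a prime with n, so
-- g(n) ≥ M + 11.  The cycle with labels 0, 1, …, M - 1, M + e₀, …, M + e₈ (nine
-- fixed residues) has k = M + 9 vertices: consecutive labels are at distance 1
-- or separated modulo 3, 5, 7 and below every q i.  It dominates X_n: each v
-- has at least 48·t + 3 labels separated from v modulo 3, 5, 7, more than the
-- primes q i, so by pigeonhole one label is incongruent to v modulo every q i.

open import Defs
open import Data.Nat using (ℕ; zero; suc; _+_; _*_; _∸_; _≤_; _<_; _≟_; _<?_; _≤?_; z≤n; s≤s; NonZero; ∣_-_∣; _!; >-nonZero; >-nonZero⁻¹; nonTrivial⇒≢1)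
open import Data.Nat.Properties
open import Data.Nat.Divisibility using (_∣_; divides; ∣-refl; ∣-trans; ∣1⇒≡1; ∣m+n∣m⇒∣n; ∣m∣n⇒∣m+n; ∣m⇒∣m*n; ∣n⇒∣m*n; m∣m*n; n∣m*n; ∣⇒≤; m≤n⇒m!∣n!)
open import Data.Nat.DivMod using (_%_; m%n<n; [m+kn]%n≡m%n; _/_; %-remove-+ʳ; m<n⇒m%n≡m; m∣n⇒o%n%m≡o%m; m*[n/m]≡n; m≥n⇒m/n>0; %-remove-+ˡ; m%n%n≡m%n)
open import Data.Nat.Coprimality using (Coprime; coprime-divisor; coprime-+; coprime?; 1-coprimeTo)
  renaming (sym to coprime-sym)
open import Data.Nat.Primality using (Prime; prime?; prime⇒irreducible; prime⇒nonTrivial; prime⇒nonZero; productOfPrimes≢0)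
open import Data.Nat.ListAction using (product)
open import Data.Nat.ListAction.Properties using (∈⇒∣product)
open import Data.Nat.Primality.Factorisation using (PrimeFactorisation; factorise)
import Data.Nat.Solver as ℕ-Solver
open import Data.Integer as ℤ using (ℤ)
import Data.Integer.Divisibility.Signed as ℤ
open import Data.Integer.DivMod using (n%ℕd<d; a≡a%ℕn+[a/ℕn]*n)
open import Data.Integer.Solver using (module +-*-Solver)
open import Data.List using (List; []; _∷_; length; map; filter; upTo; _++_; _∷ʳ_; [_])
open import Data.List.Properties using (length-map; length-++; filter-++; filter-≐; map-++; ++-assoc; upTo-∷ʳ; filter-notAll; ++-identityʳ)
open import Data.List.Relation.Unary.All using (All; []; _∷_)
import Data.List.Relation.Unary.All as All
import Data.List.Relation.Unary.All.Properties as All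
import Data.List.Relation.Unary.Any as Any
open import Data.List.Relation.Unary.AllPairs using ([]; _∷_)
open import Data.List.Relation.Unary.Unique.Propositional using (Unique)
open import Data.List.Relation.Unary.Unique.Propositional.Properties using (filter⁺; upTo⁺; ++⁺; map⁺)
open import Data.List.Relation.Unary.Unique.DecPropositional _≟_ using (unique?)
open import Data.List.Membership.Propositional using (_∈_; _∉_)
open import Data.List.Membership.Propositional.Properties using (∈-filter⁺; ∈-filter⁻; ∈-map⁺; ∈-map⁻; ∈-++⁻; ∈-upTo⁺; ∈-upTo⁻)
open import Data.List.Membership.DecPropositional _≟_ using (_∈?_)
open import Data.Fin using (Fin; toℕ; fromℕ<)
open import Data.Fin.Properties using (toℕ-fromℕ<; toℕ-injective; toℕ<n)
open import Data.Product using (∃-syntax; _×_; _,_; proj₁; proj₂)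
open import Data.Sum using (_⊎_; inj₁; inj₂)
open import Data.Empty using (⊥-elim)
open import Function using (_∘_)
open import Relation.Nullary using (¬_; Dec; yes; no; ¬?; does; map′)
open import Relation.Nullary.Decidable using (_×-dec_; _→-dec_; from-yes)
open import Data.Bool using (true; false)
open import Relation.Unary using (Pred; Decidable; _≐_)
open import Relation.Binary.PropositionalEquality using (_≡_; _≢_; refl; sym; trans; cong; cong₂; subst; subst₂; module ≡-Reasoning)

coprime-* : ∀ {a b c} → Coprime a b → Coprime a c → Coprime a (b * c)
coprime-* {a} {b} a⊥b a⊥c {d} (d∣a , d∣bc) = a⊥c (d∣a , coprime-divisor d⊥b d∣bc)
  where
  d⊥b : Coprime d b
  d⊥b (e∣d , e∣b) = a⊥b (∣-trans e∣d d∣a , e∣b)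

coprime-product : ∀ {a} qs → All (Coprime a) qs → Coprime a (product qs)
coprime-product {a} []       []           = coprime-sym (1-coprimeTo a)
coprime-product     (q ∷ qs) (a⊥q ∷ a⊥qs) = coprime-* a⊥q (coprime-product qs a⊥qs)

prime∤⇒coprime : ∀ {p a} → Prime p → ¬ p ∣ a → Coprime a p
prime∤⇒coprime p-prime p∤a (d∣a , d∣p) with prime⇒irreducible p-prime d∣p
... | inj₁ d≡1 = d≡1
... | inj₂ refl = ⊥-elim (p∤a d∣a)

prime≢1 : ∀ {p} → Prime p → p ≢ 1
prime≢1 p-prime = nonTrivial⇒≢1 {{prime⇒nonTrivial p-prime}}

∣-distance : ∀ {d a b} → d ∣ a → d ∣ b → d ∣ ∣ a - b ∣
∣-distance {d} {a} {b} d∣a d∣b with ≤-total b a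
... | inj₁ b≤a = subst (d ∣_) (sym (m≤n⇒∣n-m∣≡n∸m b≤a))
                   (∣m+n∣m⇒∣n (subst (d ∣_) (sym (m+[n∸m]≡n b≤a)) d∣a) d∣b)
... | inj₂ a≤b = subst (d ∣_) (sym (m≤n⇒∣m-n∣≡n∸m a≤b))
                   (∣m+n∣m⇒∣n (subst (d ∣_) (sym (m+[n∸m]≡n a≤b)) d∣b) d∣a)

∣∸⇒%≡ : ∀ q .{{_ : NonZero q}} {x y} → y ≤ x → q ∣ x ∸ y → x % q ≡ y % q
∣∸⇒%≡ q {x} {y} y≤x q∣x∸y = trans (cong (_% q) (sym (m+[n∸m]≡n y≤x))) (%-remove-+ʳ y q∣x∸y)

∣-distance⇒%≡ : ∀ q .{{_ : NonZero q}} a b → q ∣ ∣ a - b ∣ → a % q ≡ b % q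
∣-distance⇒%≡ q a b q∣a-b with ≤-total b a
... | inj₁ b≤a = ∣∸⇒%≡ q b≤a (subst (q ∣_) (m≤n⇒∣n-m∣≡n∸m b≤a) q∣a-b)
... | inj₂ a≤b = sym (∣∸⇒%≡ q a≤b (subst (q ∣_) (m≤n⇒∣m-n∣≡n∸m a≤b) q∣a-b))

∣-distance⇒≡ : ∀ {q a b} → a < q → b < q → q ∣ ∣ a - b ∣ → a ≡ b
∣-distance⇒≡ {q} {a} {b} a<q b<q q∣a-b = begin
  a      ≡⟨ sym (m<n⇒m%n≡m a<q) ⟩
  a % q  ≡⟨ ∣-distance⇒%≡ q a b q∣a-b ⟩
  b % q  ≡⟨ m<n⇒m%n≡m b<q ⟩
  b      ∎
  where
  open ≡-Reasoning
  instance
    q≢0 : NonZero q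
    q≢0 = >-nonZero (≤-<-trans z≤n a<q)

-- Pigeonhole: a duplicate-free list C that is longer than a list R has an
-- element outside R.  (Induct on C, deleting the head of C from R.)
pigeonhole : ∀ (C R : List ℕ) → Unique C → length R < length C → ∃[ c ] (c ∈ C × c ∉ R)
pigeonhole (c ∷ C) R (c∉C ∷ C-unique) |R|<|c∷C| with c ∈? R
... | no c∉R = c , Any.here refl , c∉R
... | yes c∈R with pigeonhole C R-c C-unique |R-c|<|C|
  where
  R-c : List ℕ
  R-c = filter (λ r → ¬? (r ≟ c)) R
  |R-c|<|C| : length R-c < length C
  |R-c|<|C| = <-≤-trans (filter-notAll (λ r → ¬? (r ≟ c)) R (Any.map (λ c≡r r≢c → r≢c (sym c≡r)) c∈R))
                        (≤-pred |R|<|c∷C|)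
...   | c′ , c′∈C , c′∉R-c =
  c′ , Any.there c′∈C , λ c′∈R → c′∉R-c (∈-filter⁺ (λ r → ¬? (r ≟ c)) c′∈R (λ c′≡c → All.lookup c∉C c′∈C (sym c′≡c)))

-- The residue of v modulo q (with the convention v mod 0 = 0).
_mod_ : ℕ → ℕ → ℕ
v mod zero  = 0
v mod suc q = v % suc q

-- Pigeonhole for residues: if the duplicate-free list C is longer than the list
-- of moduli Q, and every modulus exceeds every element of C, then some c ∈ C
-- is incongruent to v modulo every q ∈ Q (c = v mod q would be forced).
avoidResidues : ∀ v (C Q : List ℕ) → Unique C → length Q < length C →
                (∀ {c q} → c ∈ C → q ∈ Q → c < q) →
                ∃[ c ] (c ∈ C × (∀ {q} → q ∈ Q → ¬ q ∣ ∣ v - c ∣))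
avoidResidues v C Q C-unique |Q|<|C| C<Q
  with pigeonhole C (map (v mod_) Q) C-unique (subst (_< length C) (sym (length-map (v mod_) Q)) |Q|<|C|)
... | c , c∈C , c∉residues = c , c∈C , λ q∈Q q∣v-c → c∉residues (subst (_∈ map (v mod_) Q) (residue q∈Q q∣v-c) (∈-map⁺ (v mod_) q∈Q))
  where
  residue : ∀ {q} → q ∈ Q → q ∣ ∣ v - c ∣ → v mod q ≡ c
  residue {zero}  q∈Q _      = ⊥-elim (<⇒≱ (C<Q c∈C q∈Q) z≤n)
  residue {suc q} q∈Q q∣v-c = trans (∣-distance⇒%≡ (suc q) v c q∣v-c) (m<n⇒m%n≡m (C<Q c∈C q∈Q))

unique-map : ∀ {f : ℕ → ℕ} {xs} → (∀ {x y} → x ∈ xs → y ∈ xs → f x ≡ f y → x ≡ y) →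
             Unique xs → Unique (map f xs)
unique-map {xs = []}     f-inj []                 = []
unique-map {xs = x ∷ xs} f-inj (x∉xs ∷ xs-unique) =
  All.map⁺ (All.tabulate λ y∈xs fx≡fy → All.lookup x∉xs y∈xs (f-inj (Any.here refl) (Any.there y∈xs) fx≡fy))
  ∷ unique-map (λ x∈xs y∈xs → f-inj (Any.there x∈xs) (Any.there y∈xs)) xs-unique

upTo-+ : ∀ m n → upTo (m + n) ≡ upTo m ++ map (m +_) (upTo n)
upTo-+ m zero = begin
  upTo (m + 0)   ≡⟨ cong upTo (+-identityʳ m) ⟩
  upTo m         ≡⟨ sym (++-identityʳ (upTo m)) ⟩
  upTo m ++ []   ∎
  where open ≡-Reasoning
upTo-+ m (suc n) = begin
  upTo (m + suc n)                            ≡⟨ cong upTo (+-suc m n) ⟩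
  upTo (suc (m + n))                          ≡⟨ sym (upTo-∷ʳ (m + n)) ⟩
  upTo (m + n) ∷ʳ (m + n)                     ≡⟨ cong (_∷ʳ (m + n)) (upTo-+ m n) ⟩
  (upTo m ++ map (m +_) (upTo n)) ∷ʳ (m + n)  ≡⟨ ++-assoc (upTo m) (map (m +_) (upTo n)) [ m + n ] ⟩
  upTo m ++ (map (m +_) (upTo n) ∷ʳ (m + n))  ≡⟨ cong (upTo m ++_) (sym (map-++ (m +_) (upTo n) [ n ])) ⟩
  upTo m ++ map (m +_) (upTo n ∷ʳ n)          ≡⟨ cong (λ xs → upTo m ++ map (m +_) xs) (upTo-∷ʳ n) ⟩
  upTo m ++ map (m +_) (upTo (suc n))         ∎
  where open ≡-Reasoning

length-filter-map : ∀ {ℓ} {P : Pred ℕ ℓ} (P? : Decidable P) (f : ℕ → ℕ) xs →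
                    length (filter P? (map f xs)) ≡ length (filter (P? ∘ f) xs)
length-filter-map P? f []       = refl
length-filter-map P? f (x ∷ xs) with does (P? (f x))
... | true  = cong suc (length-filter-map P? f xs)
... | false = length-filter-map P? f xs

count-+ : ∀ {ℓ} {P : Pred ℕ ℓ} (P? : Decidable P) m n →
          length (filter P? (upTo (m + n))) ≡
          length (filter P? (upTo m)) + length (filter (P? ∘ (m +_)) (upTo n))
count-+ P? m n = begin
  length (filter P? (upTo (m + n)))                                ≡⟨ cong (length ∘ filter P?) (upTo-+ m n) ⟩
  length (filter P? (upTo m ++ map (m +_) (upTo n)))               ≡⟨ cong length (filter-++ P? (upTo m) (map (m +_) (upTo n))) ⟩
  length (filter P? (upTo m) ++ filter P? (map (m +_) (upTo n)))   ≡⟨ length-++ (filter P? (upTo m)) ⟩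
  length (filter P? (upTo m)) + length (filter P? (map (m +_) (upTo n)))
                                                                   ≡⟨ cong (length (filter P? (upTo m)) +_) (length-filter-map P? (m +_) (upTo n)) ⟩
  length (filter P? (upTo m)) + length (filter (P? ∘ (m +_)) (upTo n)) ∎
  where open ≡-Reasoning

Periodic : ∀ {ℓ} → ℕ → Pred ℕ ℓ → Set ℓ
Periodic p P = (P ∘ (p +_)) ≐ P

periodic-* : ∀ {ℓ} {P : Pred ℕ ℓ} p → Periodic p P → ∀ t → Periodic (t * p) P
periodic-* p per zero = (λ Px → Px) , (λ Px → Px)
periodic-* {P = P} p per (suc t) =
  (λ {x} Px → proj₁ (periodic-* p per t) (proj₁ per (subst P (+-assoc p (t * p) x) Px))) ,
  (λ {x} Px → subst P (sym (+-assoc p (t * p) x)) (proj₂ per (proj₂ (periodic-* p per t) Px)))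

count-shift : ∀ {ℓ} {P : Pred ℕ ℓ} (P? : Decidable P) s → Periodic s P → ∀ xs →
              length (filter (P? ∘ (s +_)) xs) ≡ length (filter P? xs)
count-shift P? s per xs = cong length (filter-≐ (P? ∘ (s +_)) P? per xs)

count-periodic : ∀ {ℓ} {P : Pred ℕ ℓ} (P? : Decidable P) p → Periodic p P → ∀ t →
                 length (filter P? (upTo (t * p))) ≡ t * length (filter P? (upTo p))
count-periodic P? p per zero    = refl
count-periodic P? p per (suc t) = begin
  length (filter P? (upTo (p + t * p)))                                   ≡⟨ count-+ P? p (t * p) ⟩
  length (filter P? (upTo p)) + length (filter (P? ∘ (p +_)) (upTo (t * p)))
                                                                          ≡⟨ cong (length (filter P? (upTo p)) +_) (count-shift P? p per (upTo (t * p))) ⟩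
  length (filter P? (upTo p)) + length (filter P? (upTo (t * p)))         ≡⟨ cong (length (filter P? (upTo p)) +_) (count-periodic P? p per t) ⟩
  length (filter P? (upTo p)) + t * length (filter P? (upTo p))           ∎
  where open ≡-Reasoning

coprime-periodic : ∀ a n → Periodic n (λ i → Coprime (a + i) n)
coprime-periodic a n =
  (λ {i} shifted {d} (d∣a+i , d∣n) → shifted (subst (d ∣_) (sym (swap i)) (∣m∣n⇒∣m+n d∣n d∣a+i) , d∣n)) ,
  (λ {i} coprime → subst (λ x → Coprime x n) (sym (swap i)) (coprime-+ coprime))
  where
  swap : ∀ i → a + (n + i) ≡ n + (a + i)
  swap i = trans (sym (+-assoc a n i)) (trans (cong (_+ i) (+-comm a n)) (+-assoc n a i))

hasCoprimeIn-mono : ∀ {n m m′} → m ≤ m′ → HasCoprimeIn n m → HasCoprimeIn n m′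
hasCoprimeIn-mono m≤m′ has a with has a
... | i , i<m , coprime = i , <-≤-trans i<m m≤m′ , coprime

ResidueWindows : ℕ → ℕ → Set
ResidueWindows n m = ∀ {a} → a < n → ∃[ i ] (i < m × Coprime (a + i) n)

-- Coprimality to n only depends on the residue modulo n: writing a = r + q·n
-- with r = a mod n, a common divisor of a + i and n also divides r + i.
coprime-residue : ∀ n .{{_ : NonZero n}} (a : ℤ) i →
                  Coprime (a ℤ.%ℕ n + i) n → Coprime ℤ.∣ a ℤ.+ ℤ.+ i ∣ n
coprime-residue n a i r+i⊥n {d} (d∣a+i , d∣n) = r+i⊥n (ℤ.∣⇒∣ᵤ d∣r+i , d∣n)
  where
  open +-*-Solver using (solve; _:+_; _:=_)
  r : ℕ
  r = a ℤ.%ℕ n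
  q : ℤ
  q = a ℤ./ℕ n
  a+i≡ : a ℤ.+ ℤ.+ i ≡ (ℤ.+ r ℤ.+ ℤ.+ i) ℤ.+ q ℤ.* ℤ.+ n
  a+i≡ = trans (cong (ℤ._+ ℤ.+ i) (a≡a%ℕn+[a/ℕn]*n a n))
               (solve 3 (λ x y z → (x :+ y) :+ z := (x :+ z) :+ y) refl (ℤ.+ r) (q ℤ.* ℤ.+ n) (ℤ.+ i))
  d∣r+i : ℤ.+ d ℤ.∣ ℤ.+ (r + i)
  d∣r+i = ℤ.∣m+n∣n⇒∣m (subst (ℤ.+ d ℤ.∣_) a+i≡ (ℤ.∣ᵤ⇒∣ d∣a+i)) (ℤ.∣n⇒∣m*n q (ℤ.∣ᵤ⇒∣ d∣n))

hasCoprimeIn⇒residueWindows : ∀ {n m} → HasCoprimeIn n m → ResidueWindows n m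
hasCoprimeIn⇒residueWindows has {a} _ = has (ℤ.+ a)

residueWindows⇒hasCoprimeIn : ∀ {n m} .{{_ : NonZero n}} → ResidueWindows n m → HasCoprimeIn n m
residueWindows⇒hasCoprimeIn {n} windows a with windows (n%ℕd<d a n)
... | i , i<m , coprime = i , i<m , coprime-residue n a i coprime

hasCoprimeIn? : ∀ n .{{_ : NonZero n}} m → Dec (HasCoprimeIn n m)
hasCoprimeIn? n m =
  map′ residueWindows⇒hasCoprimeIn hasCoprimeIn⇒residueWindows
       (allUpTo? (λ a → anyUpTo? (λ i → coprime? (a + i) n) m) n)

-- Every window of length n + 2 contains a number congruent to 1 modulo n.
hasCoprimeIn-2+n : ∀ n .{{_ : NonZero n}} → HasCoprimeIn n (2 + n)
hasCoprimeIn-2+n n = residueWindows⇒hasCoprimeIn window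
  where
  window : ResidueWindows n (2 + n)
  window {a} a<n = suc n ∸ a , s≤s (m∸n≤m (suc n) a) ,
    subst (λ x → Coprime x n) (trans (+-comm n 1) (sym (m+[n∸m]≡n (m≤n⇒m≤1+n (<⇒≤ a<n)))))
          (coprime-+ (1-coprimeTo n))

leastWitness : ∀ {ℓ} {P : Pred ℕ ℓ} → Decidable P → ∀ {b} → P b →
               ∃[ m ] (P m × ∀ {m′} → m′ < m → ¬ P m′)
leastWitness {P = P} P? {b} Pb = leastBelow (suc b) (b , ≤-refl , Pb)
  where
  leastBelow : ∀ c → ∃[ j ] (j < c × P j) → ∃[ m ] (P m × ∀ {m′} → m′ < m → ¬ P m′)
  leastBelow (suc c) (j , j<1+c , Pj) with anyUpTo? P? c
  ... | yes below = leastBelow c below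
  ... | no none   = j , Pj , λ m′<j Pm′ → none (_ , <-≤-trans m′<j (≤-pred j<1+c) , Pm′)

jacobsthal-exists : ∀ n .{{_ : NonZero n}} → ∃[ m ] IsJacobsthal n m
jacobsthal-exists n with leastWitness (hasCoprimeIn? n) (hasCoprimeIn-2+n n)
... | zero  , has , _     = ⊥-elim (noEmptyWindow has)
  where
  noEmptyWindow : ¬ HasCoprimeIn n 0
  noEmptyWindow has with has (ℤ.+ 0)
  ... | _ , () , _
... | suc m , has , least = suc m , s≤s z≤n , has , λ _ _ m′<m → least m′<m

jacobsthal-> : ∀ {n L m} → ¬ HasCoprimeIn n L → IsJacobsthal n m → L < m
jacobsthal-> noWindow (_ , has , _) = ≰⇒> (λ m≤L → noWindow (hasCoprimeIn-mono m≤L has))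

firstFactor : ∀ {n} → PrimeFactorisation n → ℕ
firstFactor record { factors = [] }    = 2
firstFactor record { factors = p ∷ _ } = p

firstFactor-spec : ∀ {n} (f : PrimeFactorisation n) → 2 ≤ n →
                   Prime (firstFactor f) × firstFactor f ∣ n
firstFactor-spec record { factors = [] ; isFactorisation = refl } (s≤s ())
firstFactor-spec record { factors = p ∷ ps ; isFactorisation = refl ; factorsPrime = p-prime ∷ _ } _ =
  p-prime , m∣m*n (product ps)

-- A chosen prime factor of n (meaningful for n ≥ 2).
primeFactor : ∀ n .{{_ : NonZero n}} → ℕ
primeFactor n = firstFactor (factorise n)

primeFactor-spec : ∀ n .{{_ : NonZero n}} → 2 ≤ n → Prime (primeFactor n) × primeFactor n ∣ n
primeFactor-spec n = firstFactor-spec (factorise n)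

∣! : ∀ {m n} → 1 ≤ m → m ≤ n → m ∣ n !
∣! {suc m} _ m≤n = ∣-trans (m∣m*n (m !)) (m≤n⇒m!∣n! m≤n)

-- For 1 ≤ x ≤ B we have A + x = x·(1 + c·D·(D/x)), so a prime
-- factor of 1 + c·D·(D/x) divides A + x; being coprime to D = B! it exceeds B.
module Sieve (B c : ℕ) .{{_ : NonZero c}} where

  D : ℕ
  D = B !

  A : ℕ
  A = c * D * D

  cofactor : ∀ x .{{_ : NonZero x}} → ℕ
  cofactor x = c * D * (D / x)

  sievePrime : ∀ x .{{_ : NonZero x}} → ℕ
  sievePrime x = primeFactor (suc (cofactor x))

  module _ {x} .{{_ : NonZero x}} (x≤B : x ≤ B) where

    private
      x∣D : x ∣ D
      x∣D = ∣! (>-nonZero⁻¹ x) x≤B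

      cofactor≥1 : 1 ≤ cofactor x
      cofactor≥1 = *-mono-≤ {1} {c * D} (*-mono-≤ (>-nonZero⁻¹ c) (1≤n! B)) (m≥n⇒m/n>0 {D} {x} (∣⇒≤ x∣D))
        where
        instance
          D≢0 : NonZero D
          D≢0 = >-nonZero (1≤n! B)

      spec : Prime (sievePrime x) × sievePrime x ∣ suc (cofactor x)
      spec = primeFactor-spec (suc (cofactor x)) (s≤s cofactor≥1)

    sievePrime-prime : Prime (sievePrime x)
    sievePrime-prime = proj₁ spec

    A+x≡ : A + x ≡ x * suc (cofactor x)
    A+x≡ = begin
      c * D * D + x               ≡⟨ cong (λ y → c * D * y + x) (sym (m*[n/m]≡n x∣D)) ⟩
      c * D * (x * (D / x)) + x   ≡⟨ solve 3 (λ a b y → a :* (y :* b) :+ y := y :* (con 1 :+ a :* b)) refl (c * D) (D / x) x ⟩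
      x * suc (cofactor x)        ∎
      where
      open ≡-Reasoning
      open ℕ-Solver.+-*-Solver using (solve; _:+_; _:*_; _:=_; con)

    sievePrime-∣ : sievePrime x ∣ A + x
    sievePrime-∣ = subst (sievePrime x ∣_) (sym A+x≡) (∣n⇒∣m*n x (proj₂ spec))

    -- The sieving prime does not divide D = B!, hence exceeds B.
    sievePrime-large : B < sievePrime x
    sievePrime-large = ≰⇒> λ q≤B → prime≢1 sievePrime-prime (∣1⇒≡1 (∣m+n∣m⇒∣n (q∣cofactor+1) (q∣cofactor q≤B)))
      where
      q∣cofactor+1 : sievePrime x ∣ cofactor x + 1
      q∣cofactor+1 = subst (sievePrime x ∣_) (+-comm 1 (cofactor x)) (proj₂ spec)
      q∣cofactor : sievePrime x ≤ B → sievePrime x ∣ cofactor x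
      q∣cofactor q≤B = ∣m⇒∣m*n (D / x) (∣n⇒∣m*n c (∣! (>-nonZero⁻¹ _ {{prime⇒nonZero sievePrime-prime}}) q≤B))

  -- Distinct positions in [1, B] get distinct sieving primes: a common prime q
  -- would divide the distance ∣ x - y ∣ < B < q.
  sievePrime-injective : ∀ {x y} .{{_ : NonZero x}} .{{_ : NonZero y}} → x ≤ B → y ≤ B →
                         sievePrime x ≡ sievePrime y → x ≡ y
  sievePrime-injective {x} {y} x≤B y≤B qx≡qy =
    ∣-distance⇒≡ (≤-<-trans x≤B (sievePrime-large x≤B)) (≤-<-trans y≤B (subst (B <_) (sym qx≡qy) (sievePrime-large y≤B)))
                 (subst (sievePrime x ∣_) (∣m+n-m+o∣≡∣n-o∣ A x y)
                        (∣-distance (sievePrime-∣ x≤B) (subst (_∣ A + y) (sym qx≡qy) (sievePrime-∣ y≤B))))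

record Separated (x y : ℕ) : Set where
  constructor separated
  field
    mod3 : x % 3 ≢ y % 3
    mod5 : x % 5 ≢ y % 5
    mod7 : x % 7 ≢ y % 7

separated? : ∀ x y → Dec (Separated x y)
separated? x y =
  map′ (λ (sep₃ , sep₅ , sep₇) → separated sep₃ sep₅ sep₇) (λ (separated sep₃ sep₅ sep₇) → sep₃ , sep₅ , sep₇)
       (¬? (x % 3 ≟ y % 3) ×-dec ¬? (x % 5 ≟ y % 5) ×-dec ¬? (x % 7 ≟ y % 7))

separated-irrefl : ∀ {x} → ¬ Separated x x
separated-irrefl (separated x≢x _ _) = x≢x refl

separated-resp : ∀ {x x′ y y′} → x % 105 ≡ x′ % 105 → y % 105 ≡ y′ % 105 →
                 Separated x y → Separated x′ y′
separated-resp {x} {x′} {y} {y′} x≡x′ y≡y′ (separated sep₃ sep₅ sep₇) =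
  separated (reduce 3 (divides 35 refl) sep₃) (reduce 5 (divides 21 refl) sep₅) (reduce 7 (divides 15 refl) sep₇)
  where
  reduce : ∀ p .{{_ : NonZero p}} → p ∣ 105 → x % p ≢ y % p → x′ % p ≢ y′ % p
  reduce p p∣105 x≢y x′≡y′ = x≢y (begin
    x % p         ≡⟨ sym (m∣n⇒o%n%m≡o%m p 105 x p∣105) ⟩
    x % 105 % p   ≡⟨ cong (_% p) x≡x′ ⟩
    x′ % 105 % p  ≡⟨ m∣n⇒o%n%m≡o%m p 105 x′ p∣105 ⟩
    x′ % p        ≡⟨ x′≡y′ ⟩
    y′ % p        ≡⟨ sym (m∣n⇒o%n%m≡o%m p 105 y′ p∣105) ⟩
    y′ % 105 % p  ≡⟨ cong (_% p) (sym y≡y′) ⟩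
    y % 105 % p   ≡⟨ m∣n⇒o%n%m≡o%m p 105 y p∣105 ⟩
    y % p         ∎)
    where open ≡-Reasoning

separated-periodic : ∀ v → Periodic 105 (Separated v)
separated-periodic v = (λ {x} → separated-resp refl (shift x)) , (λ {x} → separated-resp refl (sym (shift x)))
  where
  shift : ∀ x → (105 + x) % 105 ≡ x % 105
  shift x = %-remove-+ˡ x (∣-refl {105})

separated-residue : ∀ v → Separated v ≐ Separated (v % 105)
separated-residue v = separated-resp (sym (m%n%n≡m%n v 105)) refl , separated-resp (m%n%n≡m%n v 105) refl

separated⇒coprime : ∀ {x y} → Separated x y → Coprime ∣ x - y ∣ 105
separated⇒coprime {x} {y} (separated sep₃ sep₅ sep₇) =
  coprime-* (apart (from-yes (prime? 3)) sep₃)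
            (coprime-* (apart (from-yes (prime? 5)) sep₅) (apart (from-yes (prime? 7)) sep₇))
  where
  apart : ∀ {p} .{{_ : NonZero p}} → Prime p → x % p ≢ y % p → Coprime ∣ x - y ∣ p
  apart {p} p-prime x≢y = prime∤⇒coprime p-prime (x≢y ∘ ∣-distance⇒%≡ p x y)

module LabelledCycle {n k : ℕ} (label : ℕ → ℕ) (label<n : ∀ {i} → i < k → label i < n) where

  vertex : Fin k → Fin n
  vertex i = fromℕ< (label<n (toℕ<n i))

  toℕ-vertex : ∀ i → toℕ (vertex i) ≡ label (toℕ i)
  toℕ-vertex i = toℕ-fromℕ< (label<n (toℕ<n i))

  adjacent : ∀ i j → Coprime ∣ label (toℕ i) - label (toℕ j) ∣ n → Adj n (vertex i) (vertex j)
  adjacent i j = subst₂ (λ x y → Coprime ∣ x - y ∣ n) (sym (toℕ-vertex i)) (sym (toℕ-vertex j))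

  isCycle : 3 ≤ k → (∀ {i j} → i < k → j < k → label i ≡ label j → i ≡ j) →
            (∀ {i} → suc i < k → Coprime ∣ label i - label (suc i) ∣ n) →
            Coprime ∣ label (k ∸ 1) - label 0 ∣ n → IsCycle n k vertex
  isCycle 3≤k label-inj step close = 3≤k , vertex-inj , edge
    where
    vertex-inj : ∀ {i j} → vertex i ≡ vertex j → i ≡ j
    vertex-inj {i} {j} eq = toℕ-injective (label-inj (toℕ<n i) (toℕ<n j)
      (trans (sym (toℕ-vertex i)) (trans (cong toℕ eq) (toℕ-vertex j))))
    edge : ∀ i j → toℕ j ≡ suc (toℕ i) ⊎ (toℕ i ≡ k ∸ 1 × toℕ j ≡ 0) → Adj n (vertex i) (vertex j)
    edge i j (inj₁ j≡1+i) = adjacent i j (subst (λ x → Coprime ∣ label (toℕ i) - label x ∣ n) (sym j≡1+i)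
                                            (step (subst (_< k) j≡1+i (toℕ<n j))))
    edge i j (inj₂ (i≡k-1 , j≡0)) = adjacent i j (subst₂ (λ x y → Coprime ∣ label x - label y ∣ n)
                                                   (sym i≡k-1) (sym j≡0) close)

  dominates : (∀ {v} → v < n → ∃[ i ] (i < k × Coprime ∣ v - label i ∣ n)) → Dominates n k vertex
  dominates near v with near (toℕ<n v)
  ... | i , i<k , coprime = fromℕ< i<k , inj₂
    (subst (λ x → Coprime ∣ toℕ v - x ∣ n) (sym (trans (toℕ-vertex (fromℕ< i<k)) (cong label (toℕ-fromℕ< i<k)))) coprime)

-- The positions i whose number 48 + i is coprime to 105; in the sieved window
-- these are the positions that need a prime of their own.
Hole : ℕ → Set
Hole i = Coprime (48 + i) 105

hole? : ∀ i → Dec (Hole i)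
hole? i = coprime? (48 + i) 105

-- The nine residues modulo 105 that close the dominating cycle after 0, 1, …, M-1.
extra : ℕ → ℕ
extra 0 = 102
extra 1 = 83
extra 2 = 91
extra 3 = 89
extra 4 = 93
extra 5 = 94
extra 6 = 90
extra 7 = 88
extra 8 = 86
extra _ = 0

extras : List ℕ
extras = map extra (upTo 9)

holes-per-period : length (filter hole? (upTo 105)) ≡ 48
holes-per-period = refl

holes-in-tail : length (filter hole? (upTo 10)) ≡ 2
holes-in-tail = refl

hole-4 : Hole 4
hole-4 = from-yes (hole? 4)

separated-per-period : ∀ {ρ} → ρ < 105 → length (filter (separated? ρ) (upTo 105)) ≡ 48
separated-per-period = from-yes (allUpTo? (λ ρ → length (filter (separated? ρ) (upTo 105)) ≟ 48) 105)

separated-in-extras : ∀ {ρ} → ρ < 105 → 3 ≤ length (filter (separated? ρ) extras)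
separated-in-extras = from-yes (allUpTo? (λ ρ → 3 ≤? length (filter (separated? ρ) extras)) 105)

extra<105 : ∀ {j} → j < 9 → extra j < 105
extra<105 = from-yes (allUpTo? (λ j → extra j <? 105) 9)

extra-injective : ∀ {i j} → i < 9 → j < 9 → extra i ≡ extra j → i ≡ j
extra-injective i<9 = from-yes (allUpTo? (λ i → allUpTo? (λ j → (extra i ≟ extra j) →-dec (i ≟ j)) 9) 9) i<9

extras-unique : Unique extras
extras-unique = from-yes (unique? extras)

extra-entry : Separated 104 (extra 0)
extra-entry = from-yes (separated? 104 (extra 0))

extra-steps : ∀ {j} → j < 8 → Separated (extra j) (extra (suc j))
extra-steps = from-yes (allUpTo? (λ j → separated? (extra j) (extra (suc j))) 8)

extra-exit : Separated (extra 8) 0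
extra-exit = from-yes (separated? (extra 8) 0)

-- The window A + 48, …, A + 57 + M is sieved:
-- each hole i < M + 10 (t·48 + 2 of them) gets its own prime q i > B dividing
-- A + 48 + i, while every other position shares a factor with 105.  Hence
-- n = 105·∏ q i has g(n) ≥ M + 11, whereas the cycle with labels
-- 0, 1, …, M-1, M + extra 0, …, M + extra 8 has k = M + 9 vertices and
-- dominates X_n.
module Construction (N : ℕ) where

  t : ℕ
  t = suc N

  opaque
    M : ℕ
    M = t * 105

    M≡ : M ≡ t * 105
    M≡ = refl

  k : ℕ
  k = M + 9

  B : ℕ
  B = M + 105

  open Sieve B 105 using (D; A; sievePrime; sievePrime-prime; sievePrime-∣; sievePrime-large; sievePrime-injective)

  0<M : 0 < M
  0<M = subst (0 <_) (sym M≡) (s≤s z≤n)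

  105∣M : 105 ∣ M
  105∣M = subst (105 ∣_) (sym M≡) (n∣m*n t)

  M+x%105 : ∀ x → (M + x) % 105 ≡ x % 105
  M+x%105 x = %-remove-+ˡ x 105∣M

  periodic-M : ∀ {ℓ} {P : Pred ℕ ℓ} → Periodic 105 P → Periodic M P
  periodic-M {P = P} per = subst (λ m → Periodic m P) (sym M≡) (periodic-* 105 per t)

  count-below-M : ∀ {ℓ} {P : Pred ℕ ℓ} (P? : Decidable P) → Periodic 105 P →
                  length (filter P? (upTo M)) ≡ t * length (filter P? (upTo 105))
  count-below-M P? per = trans (cong (λ m → length (filter P? (upTo m))) M≡) (count-periodic P? 105 per t)

  holes : List ℕ
  holes = filter hole? (upTo (M + 10))

  hole∈holes : ∀ {i} → i < M + 10 → Hole i → i ∈ holes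
  hole∈holes i<M+10 = ∈-filter⁺ hole? (∈-upTo⁺ i<M+10)

  holes<M+10 : ∀ {i} → i ∈ holes → i < M + 10
  holes<M+10 i∈holes = ∈-upTo⁻ (proj₁ (∈-filter⁻ hole? i∈holes))

  |holes| : length holes ≡ t * 48 + 2
  |holes| = begin
    length (filter hole? (upTo (M + 10)))
      ≡⟨ count-+ hole? M 10 ⟩
    length (filter hole? (upTo M)) + length (filter (hole? ∘ (M +_)) (upTo 10))
      ≡⟨ cong₂ _+_ (count-below-M hole? (coprime-periodic 48 105)) (count-shift hole? M (periodic-M (coprime-periodic 48 105)) (upTo 10)) ⟩
    t * length (filter hole? (upTo 105)) + length (filter hole? (upTo 10))
      ≡⟨ cong₂ (λ a b → t * a + b) holes-per-period holes-in-tail ⟩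
    t * 48 + 2 ∎
    where open ≡-Reasoning

  48+i≤B : ∀ {i} → i < M + 10 → 48 + i ≤ B
  48+i≤B {i} i<M+10 = ≤-trans (<⇒≤ (+-monoʳ-< 48 i<M+10)) (≤-trans (≤-reflexive shift) (+-monoʳ-≤ M (from-yes (58 ≤? 105))))
    where
    open ℕ-Solver.+-*-Solver using (solve; _:+_; _:=_; con)
    shift : 48 + (M + 10) ≡ M + 58
    shift = solve 1 (λ m → con 48 :+ (m :+ con 10) := m :+ con 58) refl M

  q : ℕ → ℕ
  q i = sievePrime (48 + i)

  Q : List ℕ
  Q = map q holes

  n : ℕ
  n = 105 * product Q

  Q-prime : All Prime Q
  Q-prime = All.map⁺ (All.tabulate λ i∈holes → sievePrime-prime (48+i≤B (holes<M+10 i∈holes)))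

  Q-large : ∀ {p} → p ∈ Q → B < p
  Q-large p∈Q with ∈-map⁻ q p∈Q
  ... | i , i∈holes , refl = sievePrime-large (48+i≤B (holes<M+10 i∈holes))

  Q-unique : Unique Q
  Q-unique = unique-map q-injective (filter⁺ hole? (upTo⁺ (M + 10)))
    where
    q-injective : ∀ {i j} → i ∈ holes → j ∈ holes → q i ≡ q j → i ≡ j
    q-injective {i} {j} i∈ j∈ qi≡qj =
      +-cancelˡ-≡ 48 i j (sievePrime-injective (48+i≤B (holes<M+10 i∈)) (48+i≤B (holes<M+10 j∈)) qi≡qj)

  |Q| : length Q ≡ t * 48 + 2
  |Q| = trans (length-map q holes) |holes|

  Q∣n : ∀ {p} → p ∈ Q → p ∣ n
  Q∣n p∈Q = ∣n⇒∣m*n 105 (∈⇒∣product p∈Q)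

  instance
    n≢0 : NonZero n
    n≢0 = m*n≢0 105 (product Q) {{_}} {{productOfPrimes≢0 Q-prime}}

  -- All labels fit into X_n, since B < q 4 ≤ n (position 4 is a hole).
  B<n : B < n
  B<n = <-≤-trans (Q-large q₄∈Q) (∣⇒≤ (Q∣n q₄∈Q))
    where
    q₄∈Q : q 4 ∈ Q
    q₄∈Q = ∈-map⁺ q (hole∈holes (≤-trans (from-yes (5 ≤? 10)) (m≤n+m 10 M)) hole-4)

  -- The window A + 48, …, A + 57 + M contains no number coprime to n: a hole
  -- i is divisible by q i ∈ Q, any other position shares a factor with 105.
  sieved : ∀ {i} → i < M + 10 → ¬ Coprime (A + 48 + i) n
  sieved {i} i<M+10 coprime =
    prime≢1 (sievePrime-prime (48+i≤B i<M+10))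
            (coprime′ (sievePrime-∣ (48+i≤B i<M+10) , Q∣n (∈-map⁺ q (hole∈holes i<M+10 hole))))
    where
    coprime′ : Coprime (A + (48 + i)) n
    coprime′ = subst (λ x → Coprime x n) (+-assoc A 48 i) coprime
    105∣A : 105 ∣ A
    105∣A = ∣m⇒∣m*n D (m∣m*n D)
    hole : Hole i
    hole (d∣48+i , d∣105) = coprime′ (∣m∣n⇒∣m+n (∣-trans d∣105 105∣A) d∣48+i , ∣-trans d∣105 (m∣m*n (product Q)))

  window-sieved : ¬ HasCoprimeIn n (M + 10)
  window-sieved has = let (i , i<M+10 , coprime) = has (ℤ.+ (A + 48)) in sieved i<M+10 coprime

  data Position (i : ℕ) : Set where
    low  : i < M → Position i
    high : ∀ j → i ≡ M + j → Position i

  position : ∀ i → Position i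
  position i with i <? M
  ... | yes i<M = low i<M
  ... | no  i≮M = high (i ∸ M) (sym (m+[n∸m]≡n (≮⇒≥ i≮M)))

  label : ℕ → ℕ
  label i with position i
  ... | low _    = i
  ... | high j _ = M + extra j

  label-low : ∀ {i} → i < M → label i ≡ i
  label-low {i} i<M with position i
  ... | low _       = refl
  ... | high j refl = ⊥-elim (<⇒≱ i<M (m≤m+n M j))

  label-high : ∀ j → label (M + j) ≡ M + extra j
  label-high j with position (M + j)
  ... | low M+j<M   = ⊥-elim (<⇒≱ M+j<M (m≤m+n M j))
  ... | high j′ eq = cong (λ x → M + extra x) (sym (+-cancelˡ-≡ M j j′ eq))

  label<B : ∀ {i} → i < k → label i < B
  label<B {i} i<k with position i
  ... | low i<M     = <-≤-trans i<M (m≤m+n M 105)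
  ... | high j refl = +-monoʳ-< M (extra<105 (+-cancelˡ-< M j 9 i<k))

  label-injective : ∀ {i j} → i < k → j < k → label i ≡ label j → i ≡ j
  label-injective {i} {j} i<k j<k with position i | position j
  ... | low _   | low _       = λ i≡j → i≡j
  ... | low i<M | high b refl = λ i≡M+e → ⊥-elim (<⇒≱ i<M (subst (M ≤_) (sym i≡M+e) (m≤m+n M (extra b))))
  ... | high a refl | low j<M = λ M+e≡j → ⊥-elim (<⇒≱ j<M (subst (M ≤_) M+e≡j (m≤m+n M (extra a))))
  ... | high a refl | high b refl = λ eq →
    cong (M +_) (extra-injective (+-cancelˡ-< M a 9 i<k) (+-cancelˡ-< M b 9 j<k) (+-cancelˡ-≡ M _ _ eq))

  coprime-to-n : ∀ {a b} → Separated a b → (∀ {p} → p ∈ Q → ¬ p ∣ ∣ a - b ∣) → Coprime ∣ a - b ∣ n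
  coprime-to-n sep Q∤ = coprime-* (separated⇒coprime sep)
    (coprime-product Q (All.tabulate λ p∈Q → prime∤⇒coprime (All.lookup Q-prime p∈Q) (Q∤ p∈Q)))

  -- Separated numbers below B are adjacent in X_n, as every prime in Q exceeds B.
  adjacent-if-separated : ∀ {a b} → Separated a b → a < B → b < B → Coprime ∣ a - b ∣ n
  adjacent-if-separated {a} {b} sep a<B b<B = coprime-to-n sep λ p∈Q p∣a-b →
    separated-irrefl (subst (Separated a)
      (sym (∣-distance⇒≡ (<-trans a<B (Q-large p∈Q)) (<-trans b<B (Q-large p∈Q)) p∣a-b)) sep)

  -- Consecutive labels are adjacent: at distance 1 below M, and separated
  -- modulo 105 when entering and walking along the tail.
  step : ∀ {i} → suc i < k → Coprime ∣ label i - label (suc i) ∣ n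
  step {i} 1+i<k = stepAt (position (suc i))
    where
    i<k : i < k
    i<k = <-trans (n<1+n i) 1+i<k
    adjacent : Separated (label i) (label (suc i)) → Coprime ∣ label i - label (suc i) ∣ n
    adjacent sep = adjacent-if-separated sep (label<B i<k) (label<B 1+i<k)
    stepAt : Position (suc i) → Coprime ∣ label i - label (suc i) ∣ n
    stepAt (low 1+i<M) = subst₂ (λ x y → Coprime ∣ x - y ∣ n) (sym (label-low (<-trans (n<1+n i) 1+i<M))) (sym (label-low 1+i<M))
      (subst (λ d → Coprime d n) (sym (trans (cong ∣ i -_∣ (+-comm 1 i)) (∣m-m+n∣≡n i 1))) (1-coprimeTo n))
    stepAt (high zero 1+i≡M+0) = adjacent (subst₂ Separated (sym (label-low i<M)) (sym (trans (cong label 1+i≡M+0) (label-high 0)))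
      (separated-resp i≡104 (sym (M+x%105 (extra 0))) extra-entry))
      where
      1+i≡M : suc i ≡ suc (104 + N * 105)
      1+i≡M = trans 1+i≡M+0 (trans (+-identityʳ M) M≡)
      i<M : i < M
      i<M = subst (i <_) (trans 1+i≡M+0 (+-identityʳ M)) ≤-refl
      i≡104 : 104 % 105 ≡ i % 105
      i≡104 = sym (trans (cong (_% 105) (suc-injective 1+i≡M)) ([m+kn]%n≡m%n 104 N 105))
    stepAt (high (suc j) 1+i≡M+1+j) = adjacent (subst₂ Separated (sym (trans (cong label i≡M+j) (label-high j))) (sym (trans (cong label 1+i≡M+1+j) (label-high (suc j))))
      (separated-resp (sym (M+x%105 (extra j))) (sym (M+x%105 (extra (suc j)))) (extra-steps j<8)))
      where
      i≡M+j : i ≡ M + j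
      i≡M+j = suc-injective (trans 1+i≡M+1+j (+-suc M j))
      j<8 : j < 8
      j<8 = ≤-pred (+-cancelˡ-< M (suc j) 9 (subst (_< k) 1+i≡M+1+j 1+i<k))

  close : Coprime ∣ label (k ∸ 1) - label 0 ∣ n
  close = adjacent-if-separated (subst₂ Separated (sym last≡) (sym (label-low 0<M))
            (separated-resp (sym (M+x%105 (extra 8))) refl extra-exit))
            (label<B (subst (_< k) (sym k-1≡M+8) (+-monoʳ-< M (from-yes (8 <? 9)))))
            (label<B (<-≤-trans 0<M (m≤m+n M 9)))
    where
    k-1≡M+8 : k ∸ 1 ≡ M + 8
    k-1≡M+8 = +-∸-assoc M {9} {1} (s≤s z≤n)
    last≡ : label (k ∸ 1) ≡ M + extra 8
    last≡ = trans (cong label k-1≡M+8) (label-high 8)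

  cycleLabels : List ℕ
  cycleLabels = upTo M ++ map (M +_) extras

  cycleLabels-unique : Unique cycleLabels
  cycleLabels-unique = ++⁺ (upTo⁺ M) (map⁺ (+-cancelˡ-≡ M _ _) extras-unique) disjoint
    where
    disjoint : ∀ {c} → ¬ (c ∈ upTo M × c ∈ map (M +_) extras)
    disjoint (c∈low , c∈high) with ∈-map⁻ (M +_) c∈high
    ... | e , _ , refl = <⇒≱ (∈-upTo⁻ c∈low) (m≤m+n M e)

  cycleLabels-labels : ∀ {c} → c ∈ cycleLabels → ∃[ i ] (i < k × label i ≡ c)
  cycleLabels-labels c∈ with ∈-++⁻ (upTo M) c∈
  ... | inj₁ c∈low = _ , <-≤-trans (∈-upTo⁻ c∈low) (m≤m+n M 9) , label-low (∈-upTo⁻ c∈low)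
  ... | inj₂ c∈high with ∈-map⁻ (M +_) c∈high
  ...   | e , e∈extras , refl with ∈-map⁻ extra e∈extras
  ...     | j , j∈upTo9 , refl = M + j , +-monoʳ-< M (∈-upTo⁻ j∈upTo9) , label-high j

  candidates : ℕ → List ℕ
  candidates v = filter (separated? v) cycleLabels

  -- Counting modulo 105: t·48 separated labels below M and at least 3 in the tail.
  |candidates| : ∀ v → t * 48 + 3 ≤ length (candidates v)
  |candidates| v = begin
    t * 48 + 3                                                              ≤⟨ +-mono-≤ (≤-reflexive (sym count-low)) (separated-in-extras ρ<105) ⟩
    length (filter (separated? v) (upTo M)) + length (filter (separated? ρ) extras) ≡⟨ cong (length (filter (separated? v) (upTo M)) +_) (sym count-high) ⟩
    length (filter (separated? v) (upTo M)) + length (filter (separated? v) (map (M +_) extras)) ≡⟨ sym (length-++ (filter (separated? v) (upTo M))) ⟩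
    length (filter (separated? v) (upTo M) ++ filter (separated? v) (map (M +_) extras)) ≡⟨ cong length (sym (filter-++ (separated? v) (upTo M) (map (M +_) extras))) ⟩
    length (candidates v) ∎
    where
    open ≤-Reasoning
    ρ : ℕ
    ρ = v % 105
    ρ<105 : ρ < 105
    ρ<105 = m%n<n v 105
    residue : ∀ xs → length (filter (separated? v) xs) ≡ length (filter (separated? ρ) xs)
    residue xs = cong length (filter-≐ (separated? v) (separated? ρ) (separated-residue v) xs)
    count-low : length (filter (separated? v) (upTo M)) ≡ t * 48
    count-low = trans (count-below-M (separated? v) (separated-periodic v))
                (cong (t *_) (trans (residue (upTo 105)) (separated-per-period ρ<105)))
    count-high : length (filter (separated? v) (map (M +_) extras)) ≡ length (filter (separated? ρ) extras)
    count-high = trans (length-filter-map (separated? v) (M +_) extras)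
                 (trans (count-shift (separated? v) M (periodic-M (separated-periodic v)) extras) (residue extras))

  -- Every vertex v is adjacent to some label: the candidates for v outnumber the
  -- primes in Q, so one of them avoids the residue of v modulo every q ∈ Q.
  near : ∀ {v} → v < n → ∃[ i ] (i < k × Coprime ∣ v - label i ∣ n)
  near {v} _ = adjacentCandidate (avoidResidues v (candidates v) Q (filter⁺ (separated? v) cycleLabels-unique) |Q|<|C| C<Q)
    where
    |Q|<|C| : length Q < length (candidates v)
    |Q|<|C| = subst (_< length (candidates v)) (sym |Q|) (<-≤-trans (+-monoʳ-< (t * 48) (n<1+n 2)) (|candidates| v))
    candidate : ∀ {c} → c ∈ candidates v → Separated v c × c < B
    candidate c∈C =
      let (c∈cycle , sep) = ∈-filter⁻ (separated? v) c∈C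
          (i , i<k , label≡c) = cycleLabels-labels c∈cycle
      in sep , subst (_< B) label≡c (label<B i<k)
    C<Q : ∀ {c p} → c ∈ candidates v → p ∈ Q → c < p
    C<Q c∈C p∈Q = <-trans (proj₂ (candidate c∈C)) (Q-large p∈Q)
    adjacentCandidate : ∃[ c ] (c ∈ candidates v × (∀ {p} → p ∈ Q → ¬ p ∣ ∣ v - c ∣)) →
                        ∃[ i ] (i < k × Coprime ∣ v - label i ∣ n)
    adjacentCandidate (c , c∈C , Q∤v-c) =
      let (i , i<k , label≡c) = cycleLabels-labels (proj₁ (∈-filter⁻ (separated? v) c∈C))
      in i , i<k , subst (λ x → Coprime ∣ v - x ∣ n) (sym label≡c) (coprime-to-n (proj₁ (candidate c∈C)) Q∤v-c)

  label<n : ∀ {i} → i < k → label i < n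
  label<n i<k = <-trans (label<B i<k) B<n

  open LabelledCycle label label<n using (vertex; isCycle; dominates)

  dominatingCycle : HasDominatingCycle n k
  dominatingCycle = vertex , isCycle (≤-trans (from-yes (3 ≤? 9)) (m≤n+m 9 M)) label-injective step close , dominates near

  jacobsthal-bound : ∀ {g} → IsJacobsthal n g → k + 2 ≤ g
  jacobsthal-bound {g} isJ = subst (_≤ g) (sym (trans (+-assoc M 9 2) (+-suc M 10))) (jacobsthal-> window-sieved isJ)

  N≤|Q| : N ≤ length Q
  N≤|Q| = subst (N ≤_) (sym |Q|) (≤-trans (n≤1+n N) (≤-trans (m≤m*n t 48) (m≤m+n (t * 48) 2)))


theorem3p1 : ∀ (N : ℕ) → ∃[ n ] (1 ≤ n × AtLeastPrimeFactors N n × GapAtLeast2 n)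
theorem3p1 N =
  let open Construction N
      (g , g-isJacobsthal) = jacobsthal-exists n {{n≢0}}
  in n , >-nonZero⁻¹ n {{n≢0}} , (Q , Q-unique , Q-prime , All.tabulate Q∣n , N≤|Q|) ,
     g , k , g-isJacobsthal , dominatingCycle , jacobsthal-bound g-isJacobsthal
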